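{- Let $(\mathcal{R},W)$ be a Strip Packing instance, run the Bottom-Left algorithm with the $\mathcal{FQW}$-ordering $r_1,\dots,r_n$, let $a=|\mathcal{F}|$, and assume $\mathcal{Q}\neq\emptyset$ and $\max\{y_r+h_r:r\in\mathcal{Q}\}>h_{\max}$. Let $r_B$ be the leftmost bottom supporter of $r_{a+1}$ and let $r_L$ be the left rectangle of $\mathcal{Q}$. Then $y_{r_L}\le h_{\max}+h_{r_B}$.
   Context: Strip Packing: an instance $(\mathcal{R},W)$ consists of a strip $[0,W]\times[0,\infty)$ with $W>0$ and a finite set $\mathcal{R}$ of $n$ axis-parallel closed rectangles; rectangle $r$ has width $w_r\in(0,W]$ and height $h_r>0$; $h_{\max}=\max_r h_r$. A packing assigns to each $r$ a lower-left corner $(x_r,y_r)$; it is feasible if $x_r\ge0$, $x_r+w_r\le W$, $y_r\ge0$ and the open rectangles $(x_r,x_r+w_r)\times(y_r,y_r+h_r)$ are pairwise disjoint; no rotations. Bottom-Left (BL) algorithm: given an ordering $r_1,\dots,r_n$, place $r_1$ at $(0,0)$; for $i\ge2$ choose $(x_{r_i},y_{r_i})$ such that $r_1,\dots,r_i$ form a feasible packing and $(y_{r_i},x_{r_i})$ is lexicographically minimal. A bottom supporter of $r_i$ (with $y_{r_i}>0$) is a rectangle $r_j$ with $j<i$ such that $y_{r_j}+h_{r_j}=y_{r_i}$ and the $x$-intervals $(x_{r_j},x_{r_j}+w_{r_j})$ and $(x_{r_i},x_{r_i}+w_{r_i})$ intersect. $\mathcal{FQW}$-partition: go through the rectangles in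 order of non-increasing height (ties arbitrary), adding $r$ to $\mathcal{F}$ (initially empty) iff $w_r+\sum_{f\in\mathcal{F}}w_f\le W$; $\mathcal{W}=\{r\in\mathcal{R}\setminus\mathcal{F}:w_r>W/2\}$, $\mathcal{Q}=\mathcal{R}\setminus(\mathcal{F}\cup\mathcal{W})$. The $\mathcal{FQW}$-ordering lists $\mathcal{F}$ by non-increasing height, then $\mathcal{Q}$ by non-increasing width, then $\mathcal{W}$ in any order; ties arbitrary. Thus with $a=|\mathcal{F}|$, $r_{a+1}$ is the first rectangle of $\mathcal{Q}$ placed. The top rectangle $r_T$ of $\mathcal{Q}$ is a rectangle of $\mathcal{Q}$ with highest top face $y_r+h_r$, ties broken by highest bottom face $y_r$. The left rectangle $r_L$ of $\mathcal{Q}$ is the first rectangle of $\mathcal{Q}$ in the ordering with $x_r=0$; if there is none, $r_L:=r_T$.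
   Formalization: Stated only for rational instances: the strip width W, the rectangle widths and heights, and the Bottom-Left positions $(x_r,y_r)$ all take values in ℚ. -}

module Defs where

open import Data.Nat as ℕ using (ℕ)
open import Data.Fin using (Fin; toℕ)
open import Data.Rational using (ℚ; 0ℚ; ½; _+_; _*_; _<_; _≤_; _≤?_)
open import Data.List using (List; []; _∷_; length; allFin)
open import Data.List.Membership.Propositional using (_∈_)
open import Data.List.Relation.Unary.AllPairs using (AllPairs)
open import Data.List.Relation.Binary.Permutation.Propositional using (_↭_)
open import Data.Product using (_×_; ∃)
open import Data.Sum using (_⊎_)
open import Relation.Nullary using (¬_; yes; no)
open import Relation.Binary.PropositionalEquality using (_≡_; _≢_)

-- A Strip Packing instance: strip width W, rectangles indexed by Fin n
-- (the indexing order is the order r_1, ..., r_n fed to Bottom-Left).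
record Instance : Set where
  field
    W   : ℚ
    n   : ℕ
    w   : Fin n → ℚ
    h   : Fin n → ℚ
    w>0 : ∀ r → 0ℚ < w r
    w≤W : ∀ r → w r ≤ W
    h>0 : ∀ r → 0ℚ < h r

module _ (I : Instance) where
  open Instance I

  IsMaxHeight : ℚ → Set
  IsMaxHeight hm = (∀ r → h r ≤ hm) × ∃ λ r → h r ≡ hm

  greedyF : ℚ → List (Fin n) → List (Fin n)
  greedyF acc [] = []
  greedyF acc (r ∷ rs) with w r + acc ≤? W
  ... | yes _ = r ∷ greedyF (acc + w r) rs
  ... | no  _ = greedyF acc rs

  -- π : the order of non-increasing height used for the FQW-partition
  FList : List (Fin n) → List (Fin n)
  FList π = greedyF 0ℚ π

  IsF : List (Fin n) → Fin n → Set
  IsF π r = r ∈ FList π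

  IsW : List (Fin n) → Fin n → Set
  IsW π r = ¬ IsF π r × ½ * W < w r

  IsQ : List (Fin n) → Fin n → Set
  IsQ π r = ¬ IsF π r × ¬ (½ * W < w r)

  -- The indexing order 0,1,...,n-1 is an FQW-ordering w.r.t. the FQW-partition
  -- built from the non-increasing-height order π.
  record FQWOrdering (π : List (Fin n)) : Set where
    field
      π-perm   : π ↭ allFin n
      π-sorted : AllPairs (λ i j → h j ≤ h i) π
      F-first  : ∀ i j → toℕ i ℕ.< toℕ j → IsF π j → IsF π i
      W-last   : ∀ i j → toℕ i ℕ.< toℕ j → IsW π i → IsW π j
      F-height : ∀ i j → toℕ i ℕ.< toℕ j → IsF π i → IsF π j → h j ≤ h i
      Q-width  : ∀ i j → toℕ i ℕ.< toℕ j → IsQ π i → IsQ π j → w j ≤ w i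

  InOpen : ℚ → ℚ → ℚ → Set
  InOpen a len p = a < p × p < a + len

  OpenDisjoint : Fin n → ℚ → ℚ → Fin n → ℚ → ℚ → Set
  OpenDisjoint r x₁ y₁ s x₂ y₂ =
    ∀ p q → ¬ (InOpen x₁ (w r) p × InOpen y₁ (h r) q × InOpen x₂ (w s) p × InOpen y₂ (h s) q)

  ValidAt : (Fin n → ℚ) → (Fin n → ℚ) → Fin n → ℚ → ℚ → Set
  ValidAt x y i x' y' =
    0ℚ ≤ x' × x' + w i ≤ W × 0ℚ ≤ y' ×
    (∀ j → toℕ j ℕ.< toℕ i → OpenDisjoint i x' y' j (x j) (y j))

  LexLe : ℚ → ℚ → ℚ → ℚ → Set
  LexLe y₁ x₁ y₂ x₂ = y₁ < y₂ ⊎ (y₁ ≡ y₂ × x₁ ≤ x₂)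

  -- (x,y) is the packing produced by Bottom-Left on the order 0,1,...,n-1
  -- (for i = 0 this forces (0,0))
  IsBL : (Fin n → ℚ) → (Fin n → ℚ) → Set
  IsBL x y = ∀ i → ValidAt x y i (x i) (y i) ×
                   (∀ x' y' → ValidAt x y i x' y' → LexLe (y i) (x i) y' x')

  BottomSupporter : (Fin n → ℚ) → (Fin n → ℚ) → Fin n → Fin n → Set
  BottomSupporter x y j i =
    0ℚ < y i × toℕ j ℕ.< toℕ i × y j + h j ≡ y i ×
    ∃ λ p → InOpen (x j) (w j) p × InOpen (x i) (w i) p

  LeftmostBottomSupporter : (Fin n → ℚ) → (Fin n → ℚ) → Fin n → Fin n → Set
  LeftmostBottomSupporter x y b i =
    BottomSupporter x y b i × (∀ j → BottomSupporter x y j i → x b ≤ x j)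

  IsTopRect : List (Fin n) → (Fin n → ℚ) → (Fin n → ℚ) → Fin n → Set
  IsTopRect π x y t =
    IsQ π t × (∀ j → IsQ π j →
      (y j + h j < y t + h t) ⊎ (y j + h j ≡ y t + h t × y j ≤ y t))

  IsLeftRect : List (Fin n) → (Fin n → ℚ) → (Fin n → ℚ) → Fin n → Set
  IsLeftRect π x y l =
    (IsQ π l × x l ≡ 0ℚ × (∀ j → IsQ π j → x j ≡ 0ℚ → toℕ l ℕ.≤ toℕ j))
    ⊎ ((∀ j → IsQ π j → x j ≢ 0ℚ) × IsTopRect π x y l)

-- The rectangles of F are exactly r_1, ..., r_a, and BL lays them side by side on the
-- floor, r_f at x = w_1 + ... + w_(f-1). So the leftmost bottom supporter r_B of
-- r_(a+1) is in F, r_(a+1) sits at height h_B, and x_B ≤ x_(a+1), since a floor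
-- rectangle further left under r_(a+1) would be a supporter too. Every r in Q has
-- h_r ≤ h_B: the greedy step rejecting r had already taken only F rectangles taller than
-- r_B, all of them left of r_B, so W < w_r + x_B ≤ w_(a+1) + x_(a+1) ≤ W otherwise.
-- Above h_max there are only Q rectangles, and none of them has 0 < x < w: sliding it to
-- the wall would be lexicographically smaller, because a rectangle blocking the wall
-- position is an earlier, hence wider, Q rectangle and would overlap it already.
-- Therefore the wall position at height h_max + h_B is free for r_L.
{-# OPTIONS --safe #-}
module Submission where

open import Defs

open import Data.Empty using (⊥; ⊥-elim)
open import Data.Fin using (Fin; toℕ; fromℕ<)
open import Data.Fin.Induction using (<-wellFounded)
open import Data.Fin.Properties
  using (toℕ-injective; toℕ<n; toℕ-fromℕ<; fromℕ<-toℕ) renaming (_≟_ to _≟ᶠ_)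
open import Data.List using (List; []; _∷_; length; filter; foldr; map; allFin)
open import Data.List.Membership.Propositional using (_∈_; _∉_)
open import Data.List.Membership.Propositional.Properties using (∈-filter⁺; ∈-filter⁻; ∈-allFin)
open import Data.List.Membership.Propositional.Properties.WithK using (unique∧set⇒bag)
open import Data.List.Properties using (length-filter; filter-none; filter-accept)
open import Data.List.Relation.Binary.BagAndSetEquality using (∼bag⇒↭)
open import Data.List.Relation.Binary.Permutation.Propositional using (_↭_; ↭-sym; ↭⇒↭ₛ)
open import Data.List.Relation.Binary.Permutation.Propositional.Properties
  using (↭-length; map⁺; ∈-resp-↭)
import Data.List.Relation.Binary.Permutation.Setoid.Properties as PermutationSetoid
open import Data.List.Relation.Binary.Subset.Propositional using (_⊆_)
import Data.List.Relation.Unary.All as All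
open import Data.List.Relation.Unary.AllPairs using (AllPairs; []; _∷_)
open import Data.List.Relation.Unary.Any using (here; there)
open import Data.List.Relation.Unary.Unique.Propositional using (Unique)
open import Data.List.Relation.Unary.Unique.Propositional.Properties using (filter⁺; allFin⁺)
open import Data.Nat as ℕ using (ℕ; zero; suc; s≤s⁻¹)
import Data.Nat.Properties as ℕP
open import Data.Product using (_×_; ∃; _,_; proj₁; proj₂)
open import Data.Rational using (ℚ; 0ℚ; _+_; _<_; _≤_; _≮_; _<?_; _≤?_; _⊔_; _⊓_)
import Data.Rational.Properties as ℚP
open import Data.Sum using (_⊎_; inj₁; inj₂)
open import Function.Base using (id)
open import Function.Bundles using (_⇔_; mk⇔)
import Induction.WellFounded as WF
open import Relation.Binary.Definitions using (DecidableEquality; tri<; tri≈; tri>)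
open import Relation.Binary.PropositionalEquality
  using (_≡_; _≢_; refl; sym; trans; cong; subst; subst₂; setoid; ≢-sym; module ≡-Reasoning)
open import Relation.Nullary using (¬_; yes; no)
open import Relation.Unary using (Decidable)

p<p+q : ∀ p {q} → 0ℚ < q → p < p + q
p<p+q p {q} 0<q = subst (_< p + q) (ℚP.+-identityʳ p) (ℚP.+-monoʳ-< p 0<q)

p≤p+q : ∀ p {q} → 0ℚ ≤ q → p ≤ p + q
p≤p+q p {q} 0≤q = subst (_≤ p + q) (ℚP.+-identityʳ p) (ℚP.+-monoʳ-≤ p 0≤q)

p≤q+p : ∀ p {q} → 0ℚ ≤ q → p ≤ q + p
p≤q+p p {q} 0≤q = subst (_≤ q + p) (ℚP.+-identityˡ p) (ℚP.+-monoˡ-≤ p 0≤q)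

≤∧≢⇒< : ∀ {p q} → p ≤ q → p ≢ q → p < q
≤∧≢⇒< {p} {q} p≤q p≢q with ℚP.<-cmp p q
... | tri< p<q _ _ = p<q
... | tri≈ _ p≡q _ = ⊥-elim (p≢q p≡q)
... | tri> _ _ q<p = ⊥-elim (ℚP.<-irrefl refl (ℚP.≤-<-trans p≤q q<p))

open-intervals-meet : ∀ {a₁ b₁ a₂ b₂} → a₁ < b₁ → a₁ < b₂ → a₂ < b₁ → a₂ < b₂ →
  ∃ λ p → (a₁ < p × p < b₁) × (a₂ < p × p < b₂)
open-intervals-meet {a₁} {b₁} {a₂} {b₂} a₁<b₁ a₁<b₂ a₂<b₁ a₂<b₂ =
  let p , max<p , p<min = ℚP.<-dense (max<min (ℚP.⊔-sel a₁ a₂) (ℚP.⊓-sel b₁ b₂)) in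
  p , (ℚP.≤-<-trans (ℚP.p≤p⊔q a₁ a₂) max<p , ℚP.<-≤-trans p<min (ℚP.p⊓q≤p b₁ b₂))
    , (ℚP.≤-<-trans (ℚP.p≤q⊔p a₁ a₂) max<p , ℚP.<-≤-trans p<min (ℚP.p⊓q≤q b₁ b₂))
  where
  max<min : a₁ ⊔ a₂ ≡ a₁ ⊎ a₁ ⊔ a₂ ≡ a₂ → b₁ ⊓ b₂ ≡ b₁ ⊎ b₁ ⊓ b₂ ≡ b₂ → a₁ ⊔ a₂ < b₁ ⊓ b₂
  max<min (inj₁ eq) (inj₁ eq′) rewrite eq | eq′ = a₁<b₁
  max<min (inj₁ eq) (inj₂ eq′) rewrite eq | eq′ = a₁<b₂
  max<min (inj₂ eq) (inj₁ eq′) rewrite eq | eq′ = a₂<b₁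
  max<min (inj₂ eq) (inj₂ eq′) rewrite eq | eq′ = a₂<b₂

sequence-crossing : (s : ℕ → ℚ) {v : ℚ} (t : ℕ) → s 0 ≤ v → v < s t →
  ∃ λ k → k ℕ.< t × s k ≤ v × v < s (suc k)
sequence-crossing s zero s₀≤v v<s₀ = ⊥-elim (ℚP.<-irrefl refl (ℚP.≤-<-trans s₀≤v v<s₀))
sequence-crossing s {v} (suc t) s₀≤v v<sₜ₊₁ with v <? s t
... | yes v<sₜ = let k , k<t , sₖ≤v , v<sₖ₊₁ = sequence-crossing s t s₀≤v v<sₜ in
                 k , ℕP.m<n⇒m<1+n k<t , sₖ≤v , v<sₖ₊₁
... | no v≮sₜ = t , ℕP.≤-refl , ℚP.≮⇒≥ v≮sₜ , v<sₜ₊₁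

unique∧set⇒↭ : ∀ {A : Set} {xs ys : List A} → Unique xs → Unique ys →
  (∀ {z} → z ∈ xs ⇔ z ∈ ys) → xs ↭ ys
unique∧set⇒↭ uxs uys same = ∼bag⇒↭ (unique∧set⇒bag uxs uys same)

module DistinctLists {A : Set} (_≟_ : DecidableEquality A) where
  open import Data.List.Membership.DecPropositional _≟_ using (_∈?_)

  ⊆⇒↭-filter : ∀ {xs ys} → Unique xs → Unique ys → xs ⊆ ys → xs ↭ filter (_∈? xs) ys
  ⊆⇒↭-filter {xs} {ys} uxs uys xs⊆ys = unique∧set⇒↭ uxs (filter⁺ (_∈? xs) uys)
    (mk⇔ (λ z∈xs → ∈-filter⁺ (_∈? xs) (xs⊆ys z∈xs) z∈xs)
         (λ z∈f → proj₂ (∈-filter⁻ (_∈? xs) {xs = ys} z∈f)))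

  length-mono-⊆ : ∀ {xs ys} → Unique xs → Unique ys → xs ⊆ ys → length xs ℕ.≤ length ys
  length-mono-⊆ {xs} {ys} uxs uys xs⊆ys =
    ℕP.≤-trans (ℕP.≤-reflexive (↭-length (⊆⇒↭-filter uxs uys xs⊆ys))) (length-filter (_∈? xs) ys)

  module Weighted (w : A → ℚ) where

    weight : List A → ℚ
    weight xs = foldr _+_ 0ℚ (map w xs)

    weight-↭ : ∀ {xs ys} → xs ↭ ys → weight xs ≡ weight ys
    weight-↭ xs↭ys = PermutationSetoid.foldr-commMonoid (setoid ℚ) ℚP.+-0-isCommutativeMonoid
      (↭⇒↭ₛ (map⁺ w xs↭ys))

    module _ (w≥0 : ∀ a → 0ℚ ≤ w a) where

      weight-nonneg : ∀ xs → 0ℚ ≤ weight xs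
      weight-nonneg [] = ℚP.≤-refl
      weight-nonneg (x ∷ xs) = ℚP.+-mono-≤ (w≥0 x) (weight-nonneg xs)

      weight-filter-≤ : ∀ {P : A → Set} (P? : Decidable P) xs → weight (filter P? xs) ≤ weight xs
      weight-filter-≤ P? [] = ℚP.≤-refl
      weight-filter-≤ P? (x ∷ xs) with P? x
      ... | yes _ = ℚP.+-monoʳ-≤ (w x) (weight-filter-≤ P? xs)
      ... | no _ = ℚP.≤-trans (weight-filter-≤ P? xs) (p≤q+p (weight xs) (w≥0 x))

      weight-mono-⊆ : ∀ {xs ys} → Unique xs → Unique ys → xs ⊆ ys → weight xs ≤ weight ys
      weight-mono-⊆ {xs} {ys} uxs uys xs⊆ys = ℚP.≤-trans
        (ℚP.≤-reflexive (weight-↭ (⊆⇒↭-filter uxs uys xs⊆ys))) (weight-filter-≤ (_∈? xs) ys)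

module Prefixes (n : ℕ) where

  below : ℕ → List (Fin n)
  below t = filter (λ g → toℕ g ℕ.<? t) (allFin n)

  ∈-below⁺ : ∀ {g t} → toℕ g ℕ.< t → g ∈ below t
  ∈-below⁺ {g} {t} g<t = ∈-filter⁺ (λ g → toℕ g ℕ.<? t) (∈-allFin g) g<t

  ∈-below⁻ : ∀ {g t} → g ∈ below t → toℕ g ℕ.< t
  ∈-below⁻ {g} {t} g∈ = proj₂ (∈-filter⁻ (λ g → toℕ g ℕ.<? t) {xs = allFin n} g∈)

  below-unique : ∀ t → Unique (below t)
  below-unique t = filter⁺ (λ g → toℕ g ℕ.<? t) (allFin⁺ n)

  below-zero : below 0 ≡ []
  below-zero = filter-none (λ g → toℕ g ℕ.<? 0) {xs = allFin n} (All.tabulate λ _ ())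

  below-suc : ∀ {t} (t<n : t ℕ.< n) → below (suc t) ↭ fromℕ< t<n ∷ below t
  below-suc {t} t<n = unique∧set⇒↭ (below-unique (suc t)) (fresh ∷ below-unique t) (mk⇔ to from)
    where
    fresh : All.All (fromℕ< t<n ≢_) (below t)
    fresh = All.tabulate λ g∈ eq → ℕP.<-irrefl (trans (sym (cong toℕ eq)) (toℕ-fromℕ< t<n)) (∈-below⁻ g∈)
    to : ∀ {g} → g ∈ below (suc t) → g ∈ fromℕ< t<n ∷ below t
    to g∈ with ℕP.m≤n⇒m<n∨m≡n (s≤s⁻¹ (∈-below⁻ g∈))
    ... | inj₁ g<t = there (∈-below⁺ g<t)
    ... | inj₂ g≡t = here (toℕ-injective (trans g≡t (sym (toℕ-fromℕ< t<n))))
    from : ∀ {g} → g ∈ fromℕ< t<n ∷ below t → g ∈ below (suc t)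
    from (here refl) = ∈-below⁺ (ℕP.≤-reflexive (cong suc (toℕ-fromℕ< t<n)))
    from (there g∈) = ∈-below⁺ (ℕP.m<n⇒m<1+n (∈-below⁻ g∈))

  length-below : ∀ t → t ℕ.≤ n → length (below t) ≡ t
  length-below zero _ = cong length below-zero
  length-below (suc t) t<n = trans (↭-length (below-suc t<n)) (cong suc (length-below t (ℕP.<⇒≤ t<n)))

  module Offsets (w : Fin n → ℚ) (w≥0 : ∀ g → 0ℚ ≤ w g) where
    open DistinctLists (_≟ᶠ_ {n})
    open Weighted w

    offset : ℕ → ℚ
    offset t = weight (below t)

    offset-zero : offset 0 ≡ 0ℚ
    offset-zero = cong weight below-zero

    offset-suc : ∀ f → offset (suc (toℕ f)) ≡ offset (toℕ f) + w f
    offset-suc f = trans (weight-↭ (below-suc (toℕ<n f)))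
      (trans (cong (λ g → w g + offset (toℕ f)) (fromℕ<-toℕ f (toℕ<n f))) (ℚP.+-comm (w f) _))

    offset-mono : ∀ {t u} → t ℕ.≤ u → offset t ≤ offset u
    offset-mono {t} {u} t≤u = weight-mono-⊆ w≥0 (below-unique t) (below-unique u)
      (λ g∈ → ∈-below⁺ (ℕP.<-≤-trans (∈-below⁻ g∈) t≤u))

    offset-covers : ∀ f {v} → 0ℚ ≤ v → v < offset (toℕ f) →
      ∃ λ g → toℕ g ℕ.< toℕ f × offset (toℕ g) ≤ v × v < offset (toℕ g) + w g
    offset-covers f {v} 0≤v v<oₜ
      with sequence-crossing offset (toℕ f) (subst (_≤ v) (sym offset-zero) 0≤v) v<oₜ
    ... | k , k<f , oₖ≤v , v<oₖ₊₁
      with fromℕ< (ℕP.<-trans k<f (toℕ<n f)) | toℕ-fromℕ< (ℕP.<-trans k<f (toℕ<n f))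
    ... | g | refl = g , k<f , oₖ≤v , subst (v <_) (offset-suc g) v<oₖ₊₁

module Rectangles (I : Instance) where
  open Instance I

  w≥0 : ∀ r → 0ℚ ≤ w r
  w≥0 r = ℚP.<⇒≤ (w>0 r)

  overlap⇒¬disjoint : ∀ {r s x₁ y₁ x₂ y₂} → OpenDisjoint I r x₁ y₁ s x₂ y₂ →
    x₁ < x₂ + w s → x₂ < x₁ + w r → y₁ < y₂ + h s → y₂ < y₁ + h r → ⊥
  overlap⇒¬disjoint {r} {s} {x₁} {y₁} {x₂} {y₂} disjoint x₁<x₂+wₛ x₂<x₁+wᵣ y₁<y₂+hₛ y₂<y₁+hᵣ =
    let p , p∈r , p∈s = open-intervals-meet (p<p+q x₁ (w>0 r)) x₁<x₂+wₛ x₂<x₁+wᵣ (p<p+q x₂ (w>0 s))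
        q , q∈r , q∈s = open-intervals-meet (p<p+q y₁ (h>0 r)) y₁<y₂+hₛ y₂<y₁+hᵣ (p<p+q y₂ (h>0 s))
    in disjoint p q (p∈r , q∈r , p∈s , q∈s)

  LexLe⇒≤ : ∀ {y₁ x₁ y₂ x₂} → LexLe I y₁ x₁ y₂ x₂ → y₁ ≤ y₂
  LexLe⇒≤ (inj₁ y₁<y₂) = ℚP.<⇒≤ y₁<y₂
  LexLe⇒≤ (inj₂ (y₁≡y₂ , _)) = ℚP.≤-reflexive y₁≡y₂

  LexLe∧≥⇒≡×≤ : ∀ {y₁ x₁ y₂ x₂} → LexLe I y₁ x₁ y₂ x₂ → y₂ ≤ y₁ → y₁ ≡ y₂ × x₁ ≤ x₂
  LexLe∧≥⇒≡×≤ (inj₁ y₁<y₂) y₂≤y₁ = ⊥-elim (ℚP.<-irrefl refl (ℚP.<-≤-trans y₁<y₂ y₂≤y₁))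
  LexLe∧≥⇒≡×≤ (inj₂ same-row) _ = same-row

module Greedy (I : Instance) where
  open Instance I
  open Rectangles I using (w≥0)
  open DistinctLists (_≟ᶠ_ {n})
  open Weighted w

  greedyF-⊆ : ∀ acc L → greedyF I acc L ⊆ L
  greedyF-⊆ acc (r ∷ L) g∈ with w r + acc ≤? W
  greedyF-⊆ acc (r ∷ L) (here refl) | yes _ = here refl
  greedyF-⊆ acc (r ∷ L) (there g∈) | yes _ = there (greedyF-⊆ (acc + w r) L g∈)
  ... | no _ = there (greedyF-⊆ acc L g∈)

  greedyF-unique : ∀ acc {L} → Unique L → Unique (greedyF I acc L)
  greedyF-unique acc [] = []
  greedyF-unique acc {r ∷ L} (r∉L ∷ uL) with w r + acc ≤? W
  ... | yes _ = All.tabulate (λ g∈ → All.lookup r∉L (greedyF-⊆ (acc + w r) L g∈))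
                ∷ greedyF-unique (acc + w r) uL
  ... | no _ = greedyF-unique acc uL

  greedyF-fits : ∀ acc L → acc ≤ W → acc + weight (greedyF I acc L) ≤ W
  greedyF-fits acc [] acc≤W = subst (_≤ W) (sym (ℚP.+-identityʳ acc)) acc≤W
  greedyF-fits acc (r ∷ L) acc≤W with w r + acc ≤? W
  ... | yes r-fits = subst (_≤ W) (ℚP.+-assoc acc (w r) _)
                       (greedyF-fits (acc + w r) L (subst (_≤ W) (ℚP.+-comm (w r) acc) r-fits))
  ... | no _ = greedyF-fits acc L acc≤W

  greedyF-rejects : ∀ acc {L i} → AllPairs (λ r s → h s ≤ h r) L → i ∈ L → i ∉ greedyF I acc L →
    W < w i + (acc + weight (filter (λ g → h i ≤? h g) (greedyF I acc L)))
  greedyF-rejects acc {r ∷ L} {i} (r≥L ∷ sorted) i∈ i∉ with w r + acc ≤? W | i∈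
  ... | yes _ | here refl = ⊥-elim (i∉ (here refl))
  ... | yes _ | there i∈L =
    subst (λ tall → W < w i + (acc + weight tall))
      (sym (filter-accept (λ g → h i ≤? h g) (All.lookup r≥L i∈L)))
      (subst (λ s → W < w i + s) (ℚP.+-assoc acc (w r) _)
        (greedyF-rejects (acc + w r) sorted i∈L (λ i∈G → i∉ (there i∈G))))
  ... | no r-too-wide | here refl = ℚP.<-≤-trans (ℚP.≰⇒> r-too-wide)
    (ℚP.+-monoʳ-≤ (w r) (p≤p+q acc (weight-nonneg w≥0 (filter (λ g → h r ≤? h g) (greedyF I acc L)))))
  ... | no _ | there i∈L = greedyF-rejects acc sorted i∈L i∉

module BottomLeft (I : Instance) (π : List (Fin (Instance.n I))) (ord : FQWOrdering I π)
                  (x y : Fin (Instance.n I) → ℚ) (bl : IsBL I x y) where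
  open Instance I
  open FQWOrdering ord
  open Rectangles I
  open Greedy I
  open DistinctLists (_≟ᶠ_ {n})
  open Weighted w
  open Prefixes n
  open Offsets w w≥0
  open import Data.List.Membership.DecPropositional (_≟ᶠ_ {n}) using (_∈?_)

  F : List (Fin n)
  F = FList I π

  a : ℕ
  a = length F

  index≤-cases : (P : Fin n → Fin n → Set) → (∀ {i} → P i i) → (∀ {i j} → toℕ i ℕ.< toℕ j → P i j) →
    ∀ {i j} → toℕ i ℕ.≤ toℕ j → P i j
  index≤-cases P diagonal below-diagonal i≤j with ℕP.m≤n⇒m<n∨m≡n i≤j
  ... | inj₁ i<j = below-diagonal i<j
  ... | inj₂ i≡j rewrite toℕ-injective i≡j = diagonal

  F-closed-≤ : ∀ {i j} → toℕ i ℕ.≤ toℕ j → IsF I π j → IsF I π i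
  F-closed-≤ = index≤-cases (λ i j → IsF I π j → IsF I π i) id (F-first _ _)

  W-closed-≥ : ∀ {i j} → toℕ i ℕ.≤ toℕ j → IsW I π i → IsW I π j
  W-closed-≥ = index≤-cases (λ i j → IsW I π i → IsW I π j) id (W-last _ _)

  F-height-≤ : ∀ {i j} → toℕ i ℕ.≤ toℕ j → IsF I π i → IsF I π j → h j ≤ h i
  F-height-≤ = index≤-cases (λ i j → IsF I π i → IsF I π j → h j ≤ h i)
    (λ _ _ → ℚP.≤-refl) (F-height _ _)

  Q-width-≤ : ∀ {i j} → toℕ i ℕ.≤ toℕ j → IsQ I π i → IsQ I π j → w j ≤ w i
  Q-width-≤ = index≤-cases (λ i j → IsQ I π i → IsQ I π j → w j ≤ w i)
    (λ _ _ → ℚP.≤-refl) (Q-width _ _)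

  ¬F-before-Q⇒Q : ∀ {k j} → toℕ k ℕ.< toℕ j → IsQ I π j → ¬ IsF I π k → IsQ I π k
  ¬F-before-Q⇒Q k<j (_ , j-narrow) k∉F =
    k∉F , λ k-wide → j-narrow (proj₂ (W-last _ _ k<j (k∉F , k-wide)))

  π-unique : Unique π
  π-unique = PermutationSetoid.Unique-resp-↭ (setoid (Fin n)) (↭⇒↭ₛ (↭-sym π-perm)) (allFin⁺ n)

  F-unique : Unique F
  F-unique = greedyF-unique 0ℚ π-unique

  F⇒<a : ∀ {i} → IsF I π i → toℕ i ℕ.< a
  F⇒<a {i} i∈F = subst (ℕ._≤ a) (length-below (suc (toℕ i)) (toℕ<n i))
    (length-mono-⊆ (below-unique _) F-unique (λ g∈ → F-closed-≤ (s≤s⁻¹ (∈-below⁻ g∈)) i∈F))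

  <a⇒F : ∀ {i} → toℕ i ℕ.< a → IsF I π i
  <a⇒F {i} i<a with i ∈? F
  ... | yes i∈F = i∈F
  ... | no i∉F = ⊥-elim (ℕP.<⇒≱ i<a (subst (a ℕ.≤_) (length-below (toℕ i) (ℕP.<⇒≤ (toℕ<n i)))
    (length-mono-⊆ F-unique (below-unique _)
      (λ g∈F → ∈-below⁺ (ℕP.≰⇒> λ i≤g → i∉F (F-closed-≤ i≤g g∈F))))))

  ¬F⇒a≤ : ∀ {i} → ¬ IsF I π i → a ℕ.≤ toℕ i
  ¬F⇒a≤ i∉F = ℕP.≮⇒≥ λ i<a → i∉F (<a⇒F i<a)

  F-prefix-fits : ∀ f → toℕ f ℕ.< a → offset (suc (toℕ f)) ≤ W
  F-prefix-fits f f<a = ℚP.≤-trans (offset-mono f<a) (ℚP.≤-trans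
    (weight-mono-⊆ w≥0 (below-unique a) F-unique (λ g∈ → <a⇒F (∈-below⁻ g∈)))
    (subst (_≤ W) (ℚP.+-identityˡ _) (greedyF-fits 0ℚ π (ℚP.≤-trans (w≥0 f) (w≤W f)))))

  x≥0 : ∀ i → 0ℚ ≤ x i
  x≥0 i = proj₁ (proj₁ (bl i))

  y≥0 : ∀ i → 0ℚ ≤ y i
  y≥0 i = proj₁ (proj₂ (proj₂ (proj₁ (bl i))))

  placed-disjoint : ∀ i j → toℕ j ℕ.< toℕ i → OpenDisjoint I i (x i) (y i) j (x j) (y j)
  placed-disjoint i = proj₂ (proj₂ (proj₂ (proj₁ (bl i))))

  x+w≤W : ∀ i → x i + w i ≤ W
  x+w≤W i = proj₁ (proj₂ (proj₁ (bl i)))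

  bl-least : ∀ i {x′ y′} → ValidAt I x y i x′ y′ → LexLe I (y i) (x i) y′ x′
  bl-least i = proj₂ (bl i) _ _

  OnFloor : Fin n → Set
  OnFloor f = y f ≡ 0ℚ × x f ≡ offset (toℕ f)

  floor-slot-valid : ∀ f → (∀ g → toℕ g ℕ.< toℕ f → OnFloor g) → toℕ f ℕ.< a →
    ValidAt I x y f (offset (toℕ f)) 0ℚ
  floor-slot-valid f earlier-on-floor f<a =
    weight-nonneg w≥0 (below (toℕ f)) , subst (_≤ W) (offset-suc f) (F-prefix-fits f f<a) , ℚP.≤-refl ,
    λ g g<f p _ (p∈f , _ , p∈g , _) →
      let _ , xg≡og = earlier-on-floor g g<f in
      ℚP.<-asym (proj₁ p∈f) (ℚP.<-≤-trans (proj₂ p∈g) (begin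
        x g + w g              ≡⟨ cong (_+ w g) xg≡og ⟩
        offset (toℕ g) + w g   ≡⟨ offset-suc g ⟨
        offset (suc (toℕ g))   ≤⟨ offset-mono g<f ⟩
        offset (toℕ f)         ∎))
    where open ℚP.≤-Reasoning

  on-floor-step : ∀ f → (∀ g → toℕ g ℕ.< toℕ f → OnFloor g) → toℕ f ℕ.< a → OnFloor f
  on-floor-step f earlier-on-floor f<a
    with LexLe∧≥⇒≡×≤ (bl-least f (floor-slot-valid f earlier-on-floor f<a)) (y≥0 f)
  ... | yf≡0 , xf≤of = yf≡0 , ℚP.≤-antisym xf≤of (ℚP.≮⇒≥ xf≮of)
    where
    xf≮of : x f ≮ offset (toℕ f)
    xf≮of xf<of =
      let g , g<f , og≤xf , xf<og+wg = offset-covers f (x≥0 f) xf<of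
          yg≡0 , xg≡og = earlier-on-floor g g<f
      in overlap⇒¬disjoint (placed-disjoint f g g<f)
           (subst (λ s → x f < s + w g) (sym xg≡og) xf<og+wg)
           (ℚP.≤-<-trans (subst (_≤ x f) (sym xg≡og) og≤xf) (p<p+q (x f) (w>0 f)))
           (subst₂ (λ s t → s < t + h g) (sym yf≡0) (sym yg≡0) (p<p+q 0ℚ (h>0 g)))
           (subst₂ (λ s t → s < t + h f) (sym yg≡0) (sym yf≡0) (p<p+q 0ℚ (h>0 f)))

  F-on-floor : ∀ f → toℕ f ℕ.< a → OnFloor f
  F-on-floor = WF.All.wfRec <-wellFounded _ (λ f → toℕ f ℕ.< a → OnFloor f)
    λ f rec f<a → on-floor-step f (λ g g<f → rec g<f (ℕP.<-trans g<f f<a)) f<a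

  left-rect-properties : ∀ {l} → IsLeftRect I π x y l →
    IsQ I π l × (∀ {k} → IsQ I π k → toℕ k ℕ.< toℕ l → x k ≢ 0ℚ)
  left-rect-properties (inj₁ (l∈Q , _ , first)) = l∈Q , λ k∈Q k<l xk≡0 → ℕP.<⇒≱ k<l (first _ k∈Q xk≡0)
  left-rect-properties (inj₂ (none-at-wall , l∈Q , _)) = l∈Q , λ k∈Q _ → none-at-wall _ k∈Q

  earlier-under-corner⇒top≤ : ∀ {g i} → toℕ g ℕ.< toℕ i →
    x g ≤ x i → x i < x g + w g → y g ≤ y i → y g + h g ≤ y i
  earlier-under-corner⇒top≤ {g} {i} g<i xg≤xi xi<xg+wg yg≤yi = ℚP.≮⇒≥ λ yi<yg+hg →
    overlap⇒¬disjoint (placed-disjoint i g g<i) xi<xg+wg (ℚP.≤-<-trans xg≤xi (p<p+q (x i) (w>0 i)))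
      yi<yg+hg (ℚP.≤-<-trans yg≤yi (p<p+q (y i) (h>0 i)))

  module FirstQ {k₀} (k₀∈Q : IsQ I π k₀) (q : Fin n) (q≡a : toℕ q ≡ a)
                (b : Fin n) (b-lbs : LeftmostBottomSupporter I x y b q) where

    q∉F : ¬ IsF I π q
    q∉F q∈F = ℕP.<-irrefl q≡a (F⇒<a q∈F)

    ¬F⇒q≤ : ∀ {i} → ¬ IsF I π i → toℕ q ℕ.≤ toℕ i
    ¬F⇒q≤ i∉F = subst (ℕ._≤ _) (sym q≡a) (¬F⇒a≤ i∉F)

    q∈Q : IsQ I π q
    q∈Q = q∉F , λ q-wide → proj₂ k₀∈Q (proj₂ (W-closed-≥ (¬F⇒q≤ (proj₁ k₀∈Q)) (q∉F , q-wide)))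

    Q-width≤w-q : ∀ {i} → IsQ I π i → w i ≤ w q
    Q-width≤w-q i∈Q = Q-width-≤ (¬F⇒q≤ (proj₁ i∈Q)) q∈Q i∈Q

    b<a : toℕ b ℕ.< a
    b<a = subst (toℕ b ℕ.<_) q≡a (proj₁ (proj₂ (proj₁ b-lbs)))

    b∈F : IsF I π b
    b∈F = <a⇒F b<a

    b-on-floor : OnFloor b
    b-on-floor = F-on-floor b b<a

    y-q≡h-b : y q ≡ h b
    y-q≡h-b = begin
      y q       ≡⟨ proj₁ (proj₂ (proj₂ (proj₁ b-lbs))) ⟨
      y b + h b ≡⟨ cong (_+ h b) (proj₁ b-on-floor) ⟩
      0ℚ + h b  ≡⟨ ℚP.+-identityˡ (h b) ⟩
      h b       ∎
      where open ≡-Reasoning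

    floor-under-q-supports : ∀ {g} → toℕ g ℕ.< toℕ b → OnFloor g →
      x g ≤ x q → x q < x g + w g → BottomSupporter I x y g q
    floor-under-q-supports {g} g<b (yg≡0 , _) xg≤xq xq<xg+wg =
      proj₁ (proj₁ b-lbs) , g<q , g-top≡y-q ,
      open-intervals-meet (p<p+q (x g) (w>0 g)) (ℚP.≤-<-trans xg≤xq (p<p+q (x q) (w>0 q)))
                          xq<xg+wg (p<p+q (x q) (w>0 q))
      where
      open ℚP.≤-Reasoning
      g<q : toℕ g ℕ.< toℕ q
      g<q = subst (toℕ g ℕ.<_) (sym q≡a) (ℕP.<-trans g<b b<a)
      g-top≡y-q : y g + h g ≡ y q
      g-top≡y-q = ℚP.≤-antisym
        (earlier-under-corner⇒top≤ g<q xg≤xq xq<xg+wg (subst (_≤ y q) (sym yg≡0) (y≥0 q)))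
        (begin
          y q        ≡⟨ y-q≡h-b ⟩
          h b        ≤⟨ F-height-≤ (ℕP.<⇒≤ g<b) (<a⇒F (ℕP.<-trans g<b b<a)) b∈F ⟩
          h g        ≡⟨ ℚP.+-identityˡ (h g) ⟨
          0ℚ + h g   ≡⟨ cong (_+ h g) yg≡0 ⟨
          y g + h g  ∎)

    x-b≤x-q : x b ≤ x q
    x-b≤x-q = ℚP.≮⇒≥ λ xq<xb →
      let g , g<b , og≤xq , xq<og+wg = offset-covers b (x≥0 q) (subst (x q <_) (proj₂ b-on-floor) xq<xb)
          g-on-floor = F-on-floor g (ℕP.<-trans g<b b<a)
          xg≤xq = subst (_≤ x q) (sym (proj₂ g-on-floor)) og≤xq
          g-supports = floor-under-q-supports g<b g-on-floor xg≤xq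
                         (subst (λ s → x q < s + w g) (sym (proj₂ g-on-floor)) xq<og+wg)
      in ℚP.<-irrefl refl (ℚP.<-≤-trans xq<xb (ℚP.≤-trans (proj₂ b-lbs g g-supports) xg≤xq))

    taller-than-b-in-F⇒before-b : ∀ {i g} → h b < h i →
      g ∈ filter (λ g → h i ≤? h g) F → g ∈ below (toℕ b)
    taller-than-b-in-F⇒before-b {i} hb<hi g∈ =
      let g∈F , hi≤hg = ∈-filter⁻ (λ g → h i ≤? h g) {xs = F} g∈ in
      ∈-below⁺ (ℕP.≰⇒> λ b≤g →
        ℚP.<-irrefl refl (ℚP.<-≤-trans hb<hi (ℚP.≤-trans hi≤hg (F-height-≤ b≤g b∈F g∈F))))

    Q-height≤h-b : ∀ {i} → IsQ I π i → h i ≤ h b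
    Q-height≤h-b {i} i∈Q = ℚP.≮⇒≥ λ hb<hi → ℚP.<-irrefl refl (ℚP.<-≤-trans
      (greedyF-rejects 0ℚ π-sorted (∈-resp-↭ (↭-sym π-perm) (∈-allFin i)) (proj₁ i∈Q))
      (begin
        w i + (0ℚ + weight tall)      ≡⟨ cong (w i +_) (ℚP.+-identityˡ _) ⟩
        w i + weight tall             ≤⟨ ℚP.+-mono-≤ (Q-width≤w-q i∈Q)
                                           (weight-mono-⊆ w≥0 (filter⁺ _ F-unique) (below-unique _)
                                             (taller-than-b-in-F⇒before-b hb<hi)) ⟩
        w q + offset (toℕ b)          ≡⟨ cong (w q +_) (proj₂ b-on-floor) ⟨
        w q + x b                     ≤⟨ ℚP.+-monoʳ-≤ (w q) x-b≤x-q ⟩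
        w q + x q                     ≡⟨ ℚP.+-comm (w q) (x q) ⟩
        x q + w q                     ≤⟨ x+w≤W q ⟩
        W                             ∎))
      where
      open ℚP.≤-Reasoning
      tall : List (Fin n)
      tall = filter (λ g → h i ≤? h g) F

  module AboveHmax (hm : ℚ) (hm-max : IsMaxHeight I hm) where

    F-top≤hm : ∀ {f} → IsF I π f → y f + h f ≤ hm
    F-top≤hm {f} f∈F = begin
      y f + h f ≡⟨ cong (_+ h f) (proj₁ (F-on-floor f (F⇒<a f∈F))) ⟩
      0ℚ + h f  ≡⟨ ℚP.+-identityˡ (h f) ⟩
      h f       ≤⟨ proj₁ hm-max f ⟩
      hm        ∎
      where open ℚP.≤-Reasoning

    top>hm-before-Q⇒Q : ∀ {k j} → toℕ k ℕ.< toℕ j → IsQ I π j → hm < y k + h k → IsQ I π k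
    top>hm-before-Q⇒Q k<j j∈Q hm<top =
      ¬F-before-Q⇒Q k<j j∈Q λ k∈F → ℚP.<-irrefl refl (ℚP.≤-<-trans (F-top≤hm k∈F) hm<top)

    Q-above-hmax⇒¬0<x<w : ∀ {j} → IsQ I π j → hm < y j → 0ℚ < x j → x j < w j → ⊥
    Q-above-hmax⇒¬0<x<w {j} j∈Q hm<yj 0<xj xj<wj =
      ℚP.<-irrefl refl (ℚP.<-≤-trans 0<xj (proj₂ (LexLe∧≥⇒≡×≤ (bl-least j at-wall) ℚP.≤-refl)))
      where
      at-wall : ValidAt I x y j 0ℚ (y j)
      at-wall = ℚP.≤-refl , subst (_≤ W) (sym (ℚP.+-identityˡ (w j))) (w≤W j) , y≥0 j ,
        λ k k<j p r (p∈j , r∈j , p∈k , r∈k) →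
          let k∈Q = top>hm-before-Q⇒Q k<j j∈Q (ℚP.<-trans hm<yj (ℚP.<-trans (proj₁ r∈j) (proj₂ r∈k))) in
          overlap⇒¬disjoint (placed-disjoint j k k<j)
            (ℚP.<-≤-trans xj<wj (ℚP.≤-trans (Q-width k j k<j k∈Q j∈Q) (p≤q+p (w k) (x≥0 k))))
            (ℚP.<-trans (proj₁ p∈k) (ℚP.<-trans (proj₂ p∈j) (ℚP.+-monoˡ-< (w j) 0<xj)))
            (ℚP.<-trans (proj₁ r∈j) (proj₂ r∈k))
            (ℚP.<-trans (proj₁ r∈k) (proj₂ r∈j))

    first-Q-at-wall-y≤hm+H : ∀ {l H} → IsQ I π l → (∀ {k} → IsQ I π k → toℕ k ℕ.< toℕ l → x k ≢ 0ℚ) →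
      (∀ {i} → IsQ I π i → h i ≤ H) → y l ≤ hm + H
    first-Q-at-wall-y≤hm+H {l} {H} l∈Q none-earlier-at-wall Q-height≤H = LexLe⇒≤ (bl-least l at-wall)
      where
      hm≤hm+H : hm ≤ hm + H
      hm≤hm+H = p≤p+q hm (ℚP.≤-trans (ℚP.<⇒≤ (h>0 l)) (Q-height≤H l∈Q))
      0≤hm : 0ℚ ≤ hm
      0≤hm = let r , hr≡hm = proj₂ hm-max in subst (0ℚ ≤_) hr≡hm (ℚP.<⇒≤ (h>0 r))
      at-wall : ValidAt I x y l 0ℚ (hm + H)
      at-wall = ℚP.≤-refl , subst (_≤ W) (sym (ℚP.+-identityˡ (w l))) (w≤W l) , ℚP.≤-trans 0≤hm hm≤hm+H ,
        λ i i<l p r (p∈l , r∈l , p∈i , r∈i) →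
          let hm+H<top = ℚP.<-trans (proj₁ r∈l) (proj₂ r∈i)
              i∈Q = top>hm-before-Q⇒Q i<l l∈Q (ℚP.≤-<-trans hm≤hm+H hm+H<top)
          in Q-above-hmax⇒¬0<x<w i∈Q
               (ℚP.≰⇒> λ yi≤hm → ℚP.<-irrefl refl
                 (ℚP.≤-<-trans (ℚP.+-mono-≤ yi≤hm (Q-height≤H i∈Q)) hm+H<top))
               (≤∧≢⇒< (x≥0 i) (≢-sym (none-earlier-at-wall i∈Q i<l)))
               (ℚP.<-trans (proj₁ p∈i) (ℚP.<-≤-trans (subst (p <_) (ℚP.+-identityˡ (w l)) (proj₂ p∈l))
                 (Q-width i l i<l i∈Q l∈Q)))

lemma10 : (I : Instance) (π : List (Fin (Instance.n I))) → FQWOrdering I π →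
    (x y : Fin (Instance.n I) → ℚ) → IsBL I x y →
    (∃ λ k → IsQ I π k) →
    (hm : ℚ) → IsMaxHeight I hm →
    (∃ λ k → IsQ I π k × hm < y k + Instance.h I k) →
    (q : Fin (Instance.n I)) → toℕ q ≡ length (FList I π) →
    (b : Fin (Instance.n I)) → LeftmostBottomSupporter I x y b q →
    (l : Fin (Instance.n I)) → IsLeftRect I π x y l →
    y l ≤ hm + Instance.h I b
lemma10 I π ord x y bl (_ , k₀∈Q) hm hm-max _ q q≡a b b-lbs l l-left =
  let l∈Q , none-earlier-at-wall = left-rect-properties l-left in
  first-Q-at-wall-y≤hm+H l∈Q none-earlier-at-wall Q-height≤h-b
  where
  open BottomLeft I π ord x y bl
  open FirstQ k₀∈Q q q≡a b b-lbs
  open AboveHmax hm hm-max
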